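{- Let $A$ be a finite local ring with unit group $U(A)$, and let $n \geq 1$. Then \[r_{n}(A)=\frac{|A|^{n}-\sum_{u \in U(A)} w_{n+2}^{u}(A)}{|A\setminus U(A)|}.\] Moreover, if $n$ is odd, then $r_{n}(A)=\dfrac{|A|^{n}-|U(A)|\,w_{n+2}^{1_{A}}(A)}{|A\setminus U(A)|}$.
   Context: For a commutative unitary ring $A$, the continuants are defined by $K_{ -1}:=0_A$, $K_0:=1_A$, and for $i\ge1$, $K_i(X_1,\dots,X_i)$ is the determinant of the $i\times i$ tridiagonal matrix with diagonal $X_1,\dots,X_i$ and all entries on the sub- and super-diagonal equal to $1_A$; equivalently $K_n(X_1,\dots,X_n)=X_nK_{n-1}(X_1,\dots,X_{n-1})-K_{n-2}(X_1,\dots,X_{n-2})$. For $a\in A$, $R_{n}^{a}(A):=\{(a_{1},\ldots,a_{n}) \in A^{n} : K_{n}(a_{1},\ldots,a_{n})=a\}$ and $r_{n}(A):=|R_{n}^{0_{A}}(A)|$ (the number of roots of the $n$-th continuant). Set $M_{n}(a_1,\ldots,a_n):=\begin{pmatrix} a_{n} & -1_{A} \\ 1_{A} & 0_{A}\end{pmatrix}\cdots\begin{pmatrix} a_{1} & -1_{A} \\ 1_{A} & 0_{A}\end{pmatrix}$, and for $u\in U(A)$ let $w_{n}^{u}(A)$ be the number of $(a_1,\dots,a_n)\in A^n$ with $M_n(a_1,\dots,a_n)=\begin{pmatrix} u & 0_A\\ 0_A & u^{ -1}\end{pmatrix}$. -}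

module Defs where

open import Level using (0ℓ) renaming (suc to lsuc)
open import Algebra.Bundles using (CommutativeRing)
open import Data.Nat using (ℕ; zero; suc)
open import Data.Nat.ListAction using (sum)
open import Data.List using (List; []; _∷_; [_]; map; concatMap; filter; length)
open import Data.List.Relation.Unary.Any using (Any; any?; here; there)
open import Data.List.Relation.Unary.AllPairs using (AllPairs)
open import Data.Vec using (Vec; []; _∷_; toList)
open import Data.Product using (Σ; ∃; ∃-syntax; _×_; _,_; proj₁; proj₂)
open import Relation.Nullary using (¬_; Dec; yes; no)
open import Relation.Nullary.Decidable using (map′; ¬?; _×-dec_)
open import Relation.Binary using (Decidable)

record FiniteCommRing : Set₁ where
  field
    cring    : CommutativeRing 0ℓ 0ℓ
  open CommutativeRing cring public
  field
    elems    : List Carrier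
    complete : ∀ x → Any (x ≈_) elems
    distinct : AllPairs (λ x y → ¬ (x ≈ y)) elems
    _≟_      : Decidable _≈_

module _ (A : FiniteCommRing) where
  open FiniteCommRing A

  card : ℕ
  card = length elems

  IsUnit : Carrier → Set
  IsUnit u = ∃[ v ] (u * v ≈ 1#)

  isUnit? : ∀ u → Dec (IsUnit u)
  isUnit? u = map′ to from (any? (λ v → (u * v) ≟ 1#) elems)
    where
    to : ∀ {xs} → Any (λ v → u * v ≈ 1#) xs → IsUnit u
    to (here p)  = _ , p
    to (there p) = to p
    from′ : ∀ {v} → (u * v ≈ 1#) → ∀ {xs} → Any (v ≈_) xs → Any (λ w → u * w ≈ 1#) xs
    from′ p (here q)  = here (trans (*-cong refl (sym q)) p)
    from′ p (there q) = there (from′ p q)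
    from : IsUnit u → Any (λ v → u * v ≈ 1#) elems
    from (v , p) = from′ p (complete v)

  units : List Carrier
  units = filter isUnit? elems

  nonunits : List Carrier
  nonunits = filter (λ x → ¬? (isUnit? x)) elems

  record IsIdeal (I : Carrier → Set) : Set where
    field
      resp  : ∀ {x y} → x ≈ y → I x → I y
      has0  : I 0#
      add   : ∀ {x y} → I x → I y → I (x + y)
      mulˡ  : ∀ r {x} → I x → I (r * x)

  IsMaximalIdeal : (Carrier → Set) → Set₁
  IsMaximalIdeal M =
    IsIdeal M × ¬ M 1# ×
    (∀ (J : Carrier → Set) → IsIdeal J → ¬ J 1# → (∀ x → M x → J x) → ∀ x → J x → M x)

  IsLocal : Set₁
  IsLocal = Σ (Carrier → Set) λ M → IsMaximalIdeal M ×
            (∀ N → IsMaximalIdeal N → ∀ x → (N x → M x) × (M x → N x))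

  tuples : (n : ℕ) → List (Vec Carrier n)
  tuples zero    = [ [] ]
  tuples (suc n) = concatMap (λ a → map (a ∷_) (tuples n)) elems

  countTuples : (n : ℕ) → {P : Vec Carrier n → Set} → (∀ v → Dec (P v)) → ℕ
  countTuples n P? = length (filter P? (tuples n))

  -- continuants: K_{-1} = 0, K_0 = 1, K_i = a_i K_{i-1} - K_{i-2}
  -- Kaux p c as : with p = K_{i-1}, c = K_i, process the remaining a_{i+1}, ...
  Kaux : Carrier → Carrier → List Carrier → Carrier
  Kaux p c []       = c
  Kaux p c (a ∷ as) = Kaux c (a * c - p) as

  K : (n : ℕ) → Vec Carrier n → Carrier
  K n as = Kaux 0# 1# (toList as)

  r : ℕ → ℕ
  r n = countTuples n (λ as → K n as ≟ 0#)

  record Mat2 : Set where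
    constructor mat
    field m11 m12 m21 m22 : Carrier

  _⊗_ : Mat2 → Mat2 → Mat2
  mat a b c d ⊗ mat e f g h =
    mat (a * e + b * g) (a * f + b * h) (c * e + d * g) (c * f + d * h)

  gen : Carrier → Mat2
  gen a = mat a (- 1#) 1# 0#

  -- M_n(a_1,…,a_n) = gen(a_n) ⋯ gen(a_1)
  Maux : Mat2 → List Carrier → Mat2
  Maux acc []       = acc
  Maux acc (a ∷ as) = Maux (gen a ⊗ acc) as

  M : (n : ℕ) → Vec Carrier n → Mat2
  M n as = Maux (mat 1# 0# 0# 1#) (toList as)

  -- M = diag(u, u⁻¹); the (2,2) entry being u⁻¹ is expressed as (2,2)·u = 1
  IsDiagU : Carrier → Mat2 → Set
  IsDiagU u (mat a b c d) = (a ≈ u) × (b ≈ 0#) × (c ≈ 0#) × (d * u ≈ 1#)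

  isDiagU? : ∀ u m → Dec (IsDiagU u m)
  isDiagU? u (mat a b c d) = (a ≟ u) ×-dec ((b ≟ 0#) ×-dec ((c ≟ 0#) ×-dec ((d * u) ≟ 1#)))

  w : ℕ → Carrier → ℕ
  w n u = countTuples n (λ as → isDiagU? u (M n as))

  sumW : ℕ → ℕ
  sumW n = sum (map (w n) units)

-- M_n(a₁ … aₙ) has determinant 1 and first column (K_n(a₁ … aₙ), K_{n-1}(a₁ … a_{n-1})).
-- Hence, for fixed a ∈ Aⁿ, the number of (x, y) making M_{n+2}(a, x, y) diagonal is 1
-- if K_n(a) is a unit and 0 otherwise, so Σ_u w^u_{n+2} counts the a with K_n(a) a unit.
-- In a local ring the nonunits form an ideal, so for a nonunit z the equation
-- aₙ K_{n-1} − K_{n-2} = z has exactly one solution aₙ if K_{n-1} is a unit and none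
-- otherwise: every nonunit is the value of K_n exactly r_n times, and the two counts
-- add up to |A|ⁿ. For n odd, rescaling the arguments by u, u⁻¹, u, … turns M_{n+2}
-- into diag(u, 1) M_{n+2} diag(1, u)⁻¹, which maps diag(z, z⁻¹) to diag(uz, (uz)⁻¹);
-- so w^u_{n+2} = w^1_{n+2} for every unit u.

module Submission where

open import Level using (0ℓ)
open import Algebra.Bundles using (CommutativeRing)
open import Data.Nat as ℕ using (ℕ; zero; suc)
import Data.Nat.Properties as ℕ
open import Data.Vec.Properties using (toList-∷ʳ; toList-++)
open import Data.Nat.ListAction using (sum)
open import Data.List using (List; []; _∷_; map; concatMap; filter; length; _++_)
open import Data.Product using (∃; ∃₂; ∃-syntax; _×_; _,_; proj₁; proj₂)
open import Data.Sum using (_⊎_; inj₁; inj₂)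
open import Function using (_∘_; _⇔_; mk⇔; Equivalence)
open import Relation.Unary using (Pred; _⊆′_)
open import Relation.Binary using (Setoid; IsEquivalence; _Respects_; _Preserves_⟶_)
open import Data.Vec as V using (Vec; []; _∷_; toList; _∷ʳ_)
open import Data.Vec.Relation.Binary.Pointwise.Inductive as PW using (Pointwise; []; _∷_)
open import Data.List.Relation.Unary.Any as Any using (Any; here; there)
open import Data.List.Relation.Unary.All as All using (All; []; _∷_)
open import Data.List.Relation.Unary.All.Properties using (All¬⇒¬Any; all-filter)
import Data.List.Relation.Unary.Any.Properties as AnyP
open import Data.List.Relation.Unary.AllPairs using (AllPairs; _∷_)
import Data.List.Relation.Unary.AllPairs.Properties as AllPairs
open import Relation.Nullary using (¬_; Dec; yes; no; contradiction)
open import Relation.Nullary.Decidable using (¬?; _×-dec_)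
open import Relation.Binary.PropositionalEquality as ≡ using (_≡_)
open import Defs

-- `solve … refl` compares normal forms definitionally, so the coefficients must
-- compute: we use ℤ, which maps into every ring, rather than the ring itself.
module CommutativeRingSolver {c ℓ} (R : CommutativeRing c ℓ) where
  open import Algebra.Solver.Ring.AlmostCommutativeRing
    using (_-Raw-AlmostCommutative⟶_; fromCommutativeRing)
  open import Data.Integer as ℤ using (ℤ; +_; -[1+_]; _⊖_)
  import Data.Integer.Properties as ℤ
  import Data.Sign as Sign
  open import Data.Maybe using (Maybe; just; nothing)
  open CommutativeRing R
  open import Algebra.Properties.Ring ring
  open import Algebra.Properties.Semiring.Mult.TCOptimised semiring
    renaming (_×_ to _·_)
  open import Relation.Binary.Reasoning.Setoid setoid

  ⟦_⟧ℤ : ℤ → Carrier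
  ⟦ + n ⟧ℤ    = n · 1#
  ⟦ -[1+ n ] ⟧ℤ = - (suc n · 1#)

  private
    suc·1 : ∀ n → suc n · 1# ≈ 1# + n · 1#
    suc·1 n = ×-homo-+ 1# 1 n

    ⟦⊖⟧ : ∀ m n → ⟦ m ⊖ n ⟧ℤ ≈ m · 1# - n · 1#
    ⟦⊖⟧ zero    zero    = sym (-‿inverseʳ 0#)
    ⟦⊖⟧ (suc m) zero    = sym (trans (+-congˡ -0#≈0#) (+-identityʳ _))
    ⟦⊖⟧ zero    (suc n) = sym (+-identityˡ _)
    ⟦⊖⟧ (suc m) (suc n) = begin
      ⟦ suc m ⊖ suc n ⟧ℤ              ≡⟨ ≡.cong ⟦_⟧ℤ (ℤ.[1+m]⊖[1+n]≡m⊖n m n) ⟩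
      ⟦ m ⊖ n ⟧ℤ                      ≈⟨ ⟦⊖⟧ m n ⟩
      m · 1# - n · 1#                 ≈⟨ +-congʳ (sym (+-identityˡ _)) ⟩
      0# + m · 1# - n · 1#            ≈⟨ +-congʳ (+-congʳ (sym (-‿inverseʳ 1#))) ⟩
      1# - 1# + m · 1# - n · 1#       ≈⟨ +-congʳ (+-assoc _ _ _) ⟩
      1# + (- 1# + m · 1#) - n · 1#   ≈⟨ +-congʳ (+-congˡ (+-comm _ _)) ⟩
      1# + (m · 1# - 1#) - n · 1#     ≈⟨ +-congʳ (sym (+-assoc _ _ _)) ⟩
      1# + m · 1# - 1# - n · 1#       ≈⟨ +-assoc _ _ _ ⟩
      1# + m · 1# + (- 1# - n · 1#)   ≈⟨ +-congˡ (-‿+-comm 1# (n · 1#)) ⟩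
      1# + m · 1# - (1# + n · 1#)     ≈⟨ sym (+-cong (suc·1 m) (-‿cong (suc·1 n))) ⟩
      suc m · 1# - suc n · 1#         ∎

    +-homo : ∀ i j → ⟦ i ℤ.+ j ⟧ℤ ≈ ⟦ i ⟧ℤ + ⟦ j ⟧ℤ
    +-homo -[1+ m ] -[1+ n ] = begin
      - (suc (suc (m ℕ.+ n)) · 1#)  ≡⟨ ≡.cong (λ k → - (k · 1#)) (≡.sym (ℕ.+-suc (suc m) n)) ⟩
      - ((suc m ℕ.+ suc n) · 1#)    ≈⟨ -‿cong (×-homo-+ 1# (suc m) (suc n)) ⟩
      - (suc m · 1# + suc n · 1#)   ≈⟨ sym (-‿+-comm _ _) ⟩
      - (suc m · 1#) - suc n · 1#   ∎

    +-homo -[1+ m ] (+ n)    = trans (⟦⊖⟧ n (suc m)) (+-comm _ _)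
    +-homo (+ m)    -[1+ n ] = ⟦⊖⟧ m (suc n)
    +-homo (+ m)    (+ n)    = ×-homo-+ 1# m n

    signed : Sign.Sign → Carrier → Carrier
    signed Sign.+ x = x
    signed Sign.- x = - x

    ⟦⟧-signed : ∀ i → ⟦ i ⟧ℤ ≈ signed (ℤ.sign i) (ℤ.∣ i ∣ · 1#)
    ⟦⟧-signed (+ zero)  = refl
    ⟦⟧-signed (+ suc n) = refl
    ⟦⟧-signed -[1+ n ]  = refl

    ⟦◃⟧ : ∀ s n → ⟦ s ℤ.◃ n ⟧ℤ ≈ signed s (n · 1#)
    ⟦◃⟧ Sign.+ zero    = refl
    ⟦◃⟧ Sign.- zero    = sym -0#≈0#
    ⟦◃⟧ Sign.+ (suc n) = refl
    ⟦◃⟧ Sign.- (suc n) = refl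

    signed-cong : ∀ s {x y} → x ≈ y → signed s x ≈ signed s y
    signed-cong Sign.+ x≈y = x≈y
    signed-cong Sign.- x≈y = -‿cong x≈y

    signed-* : ∀ s t x y → signed (s Sign.* t) (x * y) ≈ signed s x * signed t y
    signed-* Sign.+ Sign.+ x y = refl
    signed-* Sign.+ Sign.- x y = -‿distribʳ-* x y
    signed-* Sign.- Sign.+ x y = -‿distribˡ-* x y
    signed-* Sign.- Sign.- x y = begin
      x * y         ≈⟨ sym (-‿involutive _) ⟩
      - - (x * y)   ≈⟨ -‿cong (-‿distribʳ-* x y) ⟩
      - (x * - y)   ≈⟨ -‿distribˡ-* x (- y) ⟩
      - x * - y     ∎

    *-homo : ∀ i j → ⟦ i ℤ.* j ⟧ℤ ≈ ⟦ i ⟧ℤ * ⟦ j ⟧ℤ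
    *-homo i j = begin
      ⟦ s ℤ.◃ ∣i∣ ℕ.* ∣j∣ ⟧ℤ                           ≈⟨ ⟦◃⟧ s (∣i∣ ℕ.* ∣j∣) ⟩
      signed s ((∣i∣ ℕ.* ∣j∣) · 1#)                       ≈⟨ signed-cong s (×1-homo-* ∣i∣ ∣j∣) ⟩
      signed s ((∣i∣ · 1#) * (∣j∣ · 1#))                  ≈⟨ signed-* (ℤ.sign i) (ℤ.sign j) _ _ ⟩
      signed (ℤ.sign i) (∣i∣ · 1#) * signed (ℤ.sign j) (∣j∣ · 1#) ≈⟨ sym (*-cong (⟦⟧-signed i) (⟦⟧-signed j)) ⟩
      ⟦ i ⟧ℤ * ⟦ j ⟧ℤ                                      ∎
      where
      s = ℤ.sign i Sign.* ℤ.sign j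
      ∣i∣ = ℤ.∣ i ∣
      ∣j∣ = ℤ.∣ j ∣

    -‿homo : ∀ i → ⟦ ℤ.- i ⟧ℤ ≈ - ⟦ i ⟧ℤ
    -‿homo -[1+ n ]  = sym (-‿involutive _)
    -‿homo (+ zero)  = sym -0#≈0#
    -‿homo (+ suc n) = refl

    ℤ-morphism : ℤ.+-*-rawRing -Raw-AlmostCommutative⟶ fromCommutativeRing R
    ℤ-morphism = record
      { ⟦_⟧ = ⟦_⟧ℤ ; +-homo = +-homo ; *-homo = *-homo ; -‿homo = -‿homo
      ; 0-homo = refl ; 1-homo = refl }

    ≟-coefficients : ∀ i j → Maybe (⟦ i ⟧ℤ ≈ ⟦ j ⟧ℤ)
    ≟-coefficients i j with i ℤ.≟ j
    ... | yes ≡.refl = just refl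
    ... | no _       = nothing

  open import Algebra.Solver.Ring ℤ.+-*-rawRing (fromCommutativeRing R) ℤ-morphism ≟-coefficients public

  :0# :1# : ∀ {n} → Polynomial n
  :0# = con (+ 0)
  :1# = con (+ 1)

module FiniteSums where
  open import Data.Nat using (_+_; _*_)
  open ≡ using (refl; cong; sym; trans)
  open import Data.List.Properties using (map-cong; map-cong-local; map-++; map-∘)
  open import Data.Nat.ListAction.Properties using (sum-++)
  open import Algebra.Properties.CommutativeSemigroup ℕ.+-commutativeSemigroup
    using () renaming (interchange to +-interchange)

  ∑ : {X : Set} → List X → (X → ℕ) → ℕ
  ∑ xs f = sum (map f xs)

  syntax ∑ xs (λ x → e) = ∑[ x ∈ xs ] e

  𝟙 : {P : Set} → Dec P → ℕ
  𝟙 (yes _) = 1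
  𝟙 (no _)  = 0

  module _ {P : Set} where
    𝟙-yes : (p : Dec P) → P → 𝟙 p ≡ 1
    𝟙-yes (yes _) _  = refl
    𝟙-yes (no ¬p) pr = contradiction pr ¬p

    𝟙-no : (p : Dec P) → ¬ P → 𝟙 p ≡ 0
    𝟙-no (yes pr) ¬p = contradiction pr ¬p
    𝟙-no (no _)   _  = refl

    𝟙-¬?+𝟙 : (p : Dec P) → 𝟙 (¬? p) + 𝟙 p ≡ 1
    𝟙-¬?+𝟙 (yes _) = refl
    𝟙-¬?+𝟙 (no _)  = refl

  module _ {P Q : Set} where
    𝟙-⇔ : (p : Dec P) (q : Dec Q) → (P → Q) → (Q → P) → 𝟙 p ≡ 𝟙 q
    𝟙-⇔ (yes pr) q to _    = sym (𝟙-yes q (to pr))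
    𝟙-⇔ (no ¬p)  q _  from = sym (𝟙-no q (λ qr → ¬p (from qr)))

    𝟙-× : (p : Dec P) (q : Dec Q) (pq : Dec (P × Q)) → 𝟙 pq ≡ 𝟙 p * 𝟙 q
    𝟙-× (yes pr) (yes qr) pq = 𝟙-yes pq (pr , qr)
    𝟙-× (yes _)  (no ¬q)  pq = 𝟙-no pq (λ pqr → ¬q (proj₂ pqr))
    𝟙-× (no ¬p)  q        pq = 𝟙-no pq (λ pqr → ¬p (proj₁ pqr))

  module _ {X : Set} where
    length-filter≡∑𝟙 : {P : X → Set} (P? : ∀ x → Dec (P x)) (xs : List X) →
      length (filter P? xs) ≡ ∑[ x ∈ xs ] 𝟙 (P? x)
    length-filter≡∑𝟙 P? []       = refl
    length-filter≡∑𝟙 P? (x ∷ xs) with P? x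
    ... | yes _ = cong suc (length-filter≡∑𝟙 P? xs)
    ... | no _  = length-filter≡∑𝟙 P? xs

    ∑-cong : ∀ (xs : List X) {f g : X → ℕ} → (∀ x → f x ≡ g x) → ∑ xs f ≡ ∑ xs g
    ∑-cong xs f≗g = cong sum (map-cong f≗g xs)

    ∑-const : ∀ (xs : List X) k → ∑[ x ∈ xs ] k ≡ length xs * k
    ∑-const []       k = refl
    ∑-const (x ∷ xs) k = cong (k +_) (∑-const xs k)

    ∑-++ : ∀ (xs ys : List X) f → ∑ (xs ++ ys) f ≡ ∑ xs f + ∑ ys f
    ∑-++ xs ys f = trans (cong sum (map-++ f xs ys)) (sum-++ (map f xs) (map f ys))

    ∑-+ : ∀ (xs : List X) f g → ∑[ x ∈ xs ] (f x + g x) ≡ ∑ xs f + ∑ xs g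
    ∑-+ []       f g = refl
    ∑-+ (x ∷ xs) f g = trans (cong (f x + g x +_) (∑-+ xs f g))
                             (+-interchange (f x) (g x) (∑ xs f) (∑ xs g))

    ∑-cong-All : ∀ {P : X → Set} {xs} {f g : X → ℕ} → All P xs → (∀ {x} → P x → f x ≡ g x) → ∑ xs f ≡ ∑ xs g
    ∑-cong-All pxs f≗g = cong sum (map-cong-local (All.map f≗g pxs))

    ∑-*ˡ : ∀ (xs : List X) k f → ∑[ x ∈ xs ] (k * f x) ≡ k * ∑ xs f
    ∑-*ˡ []       k f = sym (ℕ.*-zeroʳ k)
    ∑-*ˡ (x ∷ xs) k f = trans (cong (k * f x +_) (∑-*ˡ xs k f)) (sym (ℕ.*-distribˡ-+ k (f x) _))

    ∑-*ʳ : ∀ (xs : List X) f k → ∑[ x ∈ xs ] (f x * k) ≡ ∑ xs f * k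
    ∑-*ʳ xs f k = trans (∑-cong xs (λ x → ℕ.*-comm (f x) k)) (trans (∑-*ˡ xs k f) (ℕ.*-comm k _))

  module _ {X Y : Set} where
    ∑-map : ∀ (xs : List X) (h : X → Y) f → ∑ (map h xs) f ≡ ∑[ x ∈ xs ] f (h x)
    ∑-map xs h f = cong sum (sym (map-∘ xs))

    ∑-concatMap : ∀ (xs : List X) (g : X → List Y) f → ∑ (concatMap g xs) f ≡ ∑[ x ∈ xs ] ∑ (g x) f
    ∑-concatMap []       g f = refl
    ∑-concatMap (x ∷ xs) g f = trans (∑-++ (g x) (concatMap g xs) f) (cong (∑ (g x) f +_) (∑-concatMap xs g f))

    ∑-comm : ∀ (xs : List X) (ys : List Y) (f : X → Y → ℕ) →
      ∑[ x ∈ xs ] ∑[ y ∈ ys ] f x y ≡ ∑[ y ∈ ys ] ∑[ x ∈ xs ] f x y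
    ∑-comm []       ys f = sym (trans (∑-const ys 0) (ℕ.*-zeroʳ (length ys)))
    ∑-comm (x ∷ xs) ys f = trans (cong (∑ ys (f x) +_) (∑-comm xs ys f)) (sym (∑-+ ys (f x) _))

open FiniteSums

module UnitsAndIdeals (A : FiniteCommRing) where
  open FiniteCommRing A hiding (zero)
  open CommutativeRingSolver cring
  open import Relation.Binary.Reasoning.Setoid setoid

  IsUnit-resp : ∀ {x y} → x ≈ y → IsUnit A x → IsUnit A y
  IsUnit-resp x≈y (x⁻¹ , xx⁻¹≈1) = x⁻¹ , trans (*-congʳ (sym x≈y)) xx⁻¹≈1

  nonunit-resp : ∀ {x y} → x ≈ y → ¬ IsUnit A x → ¬ IsUnit A y
  nonunit-resp x≈y x-nonunit = x-nonunit ∘ IsUnit-resp (sym x≈y)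

  *-cancelʳ-unit : ∀ {a b c c⁻¹} → c * c⁻¹ ≈ 1# → a * c ≈ b * c → a ≈ b
  *-cancelʳ-unit {a} {b} {c} {c⁻¹} cc⁻¹≈1 ac≈bc = begin
    a                ≈⟨ sym (*-identityʳ a) ⟩
    a * 1#           ≈⟨ *-congˡ (sym cc⁻¹≈1) ⟩
    a * (c * c⁻¹)    ≈⟨ sym (*-assoc a c c⁻¹) ⟩
    a * c * c⁻¹      ≈⟨ *-congʳ ac≈bc ⟩
    b * c * c⁻¹      ≈⟨ *-assoc b c c⁻¹ ⟩
    b * (c * c⁻¹)    ≈⟨ *-congˡ cc⁻¹≈1 ⟩
    b * 1#           ≈⟨ *-identityʳ b ⟩
    b                ∎

  *-unit-solution : ∀ {c c⁻¹} b → c * c⁻¹ ≈ 1# → b * c⁻¹ * c ≈ b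
  *-unit-solution {c} {c⁻¹} b cc⁻¹≈1 = begin
    b * c⁻¹ * c    ≈⟨ solve 3 (λ b c d → b :* d :* c := b :* (c :* d)) refl b c c⁻¹ ⟩
    b * (c * c⁻¹)  ≈⟨ *-congˡ cc⁻¹≈1 ⟩
    b * 1#         ≈⟨ *-identityʳ b ⟩
    b              ∎

  x-y≈z⇔x≈z+y : ∀ {x y z} → x - y ≈ z ⇔ x ≈ z + y
  x-y≈z⇔x≈z+y {x} {y} {z} = mk⇔
    (λ x-y≈z → trans (solve 2 (λ x y → x := x :- y :+ y) refl x y) (+-congʳ x-y≈z))
    (λ x≈z+y → trans (+-congʳ x≈z+y) (solve 2 (λ z y → z :+ y :- y := z) refl z y))

  unit∉proper : ∀ {I} → IsIdeal A I → ¬ I 1# → ∀ {x} → I x → ¬ IsUnit A x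
  unit∉proper I-ideal 1∉I x∈I (x⁻¹ , xx⁻¹≈1) =
    1∉I (resp (trans (*-comm x⁻¹ _) xx⁻¹≈1) (mulˡ x⁻¹ x∈I))
    where open IsIdeal I-ideal

  IsIdeal-combination : ∀ {I} → IsIdeal A I → ∀ r s {x y} → I x → I y → I (r * x + s * y)
  IsIdeal-combination I-ideal r s x∈I y∈I = add (mulˡ r x∈I) (mulˡ s y∈I)
    where open IsIdeal I-ideal

  principal : Carrier → Pred Carrier 0ℓ
  principal c z = ∃[ r ] z ≈ r * c

  principal-isIdeal : ∀ c → IsIdeal A (principal c)
  principal-isIdeal c = record
    { resp = λ { z≈z′ (r , z≈rc) → r , trans (sym z≈z′) z≈rc }
    ; has0 = 0# , sym (zeroˡ c)
    ; add  = λ { (r , x≈rc) (s , y≈sc) → r + s , trans (+-cong x≈rc y≈sc) (sym (distribʳ c r s)) }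
    ; mulˡ = λ { s (r , x≈rc) → s * r , trans (*-congˡ x≈rc) (sym (*-assoc s r c)) }
    }

  _+⟨_⟩ : Pred Carrier 0ℓ → Carrier → Pred Carrier 0ℓ
  (I +⟨ y ⟩) z = ∃₂ λ i r → I i × z ≈ i + r * y

  -- The side condition keeping I + (y) proper is part of the predicate, so no
  -- decision procedure for properness is needed.
  extend : Pred Carrier 0ℓ → Carrier → Pred Carrier 0ℓ
  extend I y z = I z ⊎ (¬ (I +⟨ y ⟩) 1# × (I +⟨ y ⟩) z)

  saturate : Pred Carrier 0ℓ → List Carrier → Pred Carrier 0ℓ
  saturate I []       = I
  saturate I (y ∷ ys) = saturate (extend I y) ys

  module _ {I : Pred Carrier 0ℓ} (I-ideal : IsIdeal A I) (y : Carrier) where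
    open IsIdeal I-ideal

    ⊆-+⟨⟩ : I ⊆′ (I +⟨ y ⟩)
    ⊆-+⟨⟩ z z∈I = z , 0# , z∈I , solve 2 (λ z y → z := z :+ :0# :* y) refl z y

    +⟨⟩-isIdeal : IsIdeal A (I +⟨ y ⟩)
    +⟨⟩-isIdeal = record
      { resp = λ { z≈z′ (i , r , i∈I , z≈) → i , r , i∈I , trans (sym z≈z′) z≈ }
      ; has0 = 0# , 0# , has0 , solve 1 (λ y → :0# := :0# :+ :0# :* y) refl y
      ; add  = λ { (i , r , i∈I , x≈) (j , s , j∈I , x′≈) → i + j , r + s , add i∈I j∈I ,
                   trans (+-cong x≈ x′≈)
                     (solve 5 (λ i r j s y → i :+ r :* y :+ (j :+ s :* y) := i :+ j :+ (r :+ s) :* y)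
                       refl i r j s y) }
      ; mulˡ = λ { s (i , r , i∈I , x≈) → s * i , s * r , mulˡ s i∈I ,
                   trans (*-congˡ x≈) (solve 4 (λ s i r y → s :* (i :+ r :* y) := s :* i :+ s :* r :* y) refl s i r y) }
      }

    extend-isIdeal : IsIdeal A (extend I y)
    extend-isIdeal = record
      { resp = λ { z≈z′ (inj₁ z∈I) → inj₁ (resp z≈z′ z∈I)
                 ; z≈z′ (inj₂ (proper , z∈)) → inj₂ (proper , J.resp z≈z′ z∈) }
      ; has0 = inj₁ has0
      ; add  = λ { (inj₁ x∈I) (inj₁ x′∈I) → inj₁ (add x∈I x′∈I)
                 ; (inj₁ x∈I) (inj₂ (proper , x′∈)) → inj₂ (proper , J.add (⊆-+⟨⟩ _ x∈I) x′∈)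
                 ; (inj₂ (proper , x∈)) (inj₁ x′∈I) → inj₂ (proper , J.add x∈ (⊆-+⟨⟩ _ x′∈I))
                 ; (inj₂ (proper , x∈)) (inj₂ (_ , x′∈)) → inj₂ (proper , J.add x∈ x′∈) }
      ; mulˡ = λ { s (inj₁ x∈I) → inj₁ (mulˡ s x∈I)
                 ; s (inj₂ (proper , x∈)) → inj₂ (proper , J.mulˡ s x∈) }
      }
      where module J = IsIdeal +⟨⟩-isIdeal

  extend-proper : ∀ {I} y → ¬ I 1# → ¬ extend I y 1#
  extend-proper y 1∉I (inj₁ 1∈I)        = 1∉I 1∈I
  extend-proper y 1∉I (inj₂ (proper , 1∈)) = proper 1∈

  saturate-isIdeal : ∀ ys {I} → IsIdeal A I → IsIdeal A (saturate I ys)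
  saturate-isIdeal []       I-ideal = I-ideal
  saturate-isIdeal (y ∷ ys) I-ideal = saturate-isIdeal ys (extend-isIdeal I-ideal y)

  saturate-proper : ∀ ys {I} → ¬ I 1# → ¬ saturate I ys 1#
  saturate-proper []       1∉I = 1∉I
  saturate-proper (y ∷ ys) 1∉I = saturate-proper ys (extend-proper y 1∉I)

  ⊆-saturate : ∀ ys {I} → I ⊆′ saturate I ys
  ⊆-saturate []       z z∈I = z∈I
  ⊆-saturate (y ∷ ys) z z∈I = ⊆-saturate ys z (inj₁ z∈I)

  saturate-maximal : ∀ ys {I} → IsIdeal A I → ∀ {J} → IsIdeal A J → ¬ J 1# →
    saturate I ys ⊆′ J → ∀ y → Any (y ≈_) ys → J y → saturate I ys y
  saturate-maximal (y′ ∷ ys) {I} I-ideal {J} J-ideal 1∉J sat⊆J y (here y≈y′) y∈J =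
    ⊆-saturate ys y (inj₂ (proper , 0# , 1# , IsIdeal.has0 I-ideal , y≈))
    where
    open IsIdeal J-ideal
    I⊆J : I ⊆′ J
    I⊆J z z∈I = sat⊆J z (⊆-saturate ys z (inj₁ z∈I))
    proper : ¬ (I +⟨ y′ ⟩) 1#
    proper (i , r , i∈I , 1≈) = 1∉J (resp (sym 1≈) (add (I⊆J i i∈I) (mulˡ r (resp y≈y′ y∈J))))
    y≈ : y ≈ 0# + 1# * y′
    y≈ = trans y≈y′ (solve 1 (λ y → y := :0# :+ :1# :* y) refl y′)
  saturate-maximal (y′ ∷ ys) I-ideal J-ideal 1∉J sat⊆J y (there y∈ys) y∈J =
    saturate-maximal ys (extend-isIdeal I-ideal y′) J-ideal 1∉J sat⊆J y y∈ys y∈J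

  saturate-isMaximal : ∀ {I} → IsIdeal A I → ¬ I 1# → IsMaximalIdeal A (saturate I elems)
  saturate-isMaximal I-ideal 1∉I =
    saturate-isIdeal elems I-ideal , saturate-proper elems 1∉I ,
    λ J J-ideal 1∉J sat⊆J y → saturate-maximal elems I-ideal J-ideal 1∉J sat⊆J y (complete y)

  module _ (local : IsLocal A) where
    private
      𝔪 = proj₁ local
      𝔪-ideal = proj₁ (proj₁ (proj₂ local))
      1∉𝔪 = proj₁ (proj₂ (proj₁ (proj₂ local)))

    -- Saturating the proper ideal (c) over all of A gives a maximal ideal containing c,
    -- which locality identifies with 𝔪.
    nonunit∈𝔪 : ∀ {c} → ¬ IsUnit A c → 𝔪 c
    nonunit∈𝔪 {c} c-nonunit =
      proj₁ (proj₂ (proj₂ local) _ (saturate-isMaximal (principal-isIdeal c) (c-nonunit ∘ unit)) c)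
        (⊆-saturate elems c (1# , sym (*-identityˡ c)))
      where
      unit : principal c 1# → IsUnit A c
      unit (r , 1≈rc) = r , trans (*-comm c r) (sym 1≈rc)

    nonunit-combination : ∀ r s {x y} → ¬ IsUnit A x → ¬ IsUnit A y → ¬ IsUnit A (r * x + s * y)
    nonunit-combination r s x-nonunit y-nonunit =
      unit∉proper 𝔪-ideal 1∉𝔪 (IsIdeal-combination 𝔪-ideal r s (nonunit∈𝔪 x-nonunit) (nonunit∈𝔪 y-nonunit))

    0-nonunit : ¬ IsUnit A 0#
    0-nonunit = unit∉proper 𝔪-ideal 1∉𝔪 (IsIdeal.has0 𝔪-ideal)

module Matrices (A : FiniteCommRing) where
  open FiniteCommRing A hiding (zero)
  open CommutativeRingSolver cring

  Mat : Set
  Mat = Mat2 A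

  infix 4 _≋_

  _≋_ : Mat → Mat → Set
  mat a b c d ≋ mat a′ b′ c′ d′ = a ≈ a′ × b ≈ b′ × c ≈ c′ × d ≈ d′

  ≋-isEquivalence : IsEquivalence _≋_
  ≋-isEquivalence = record
    { refl  = refl , refl , refl , refl
    ; sym   = λ { (a , b , c , d) → sym a , sym b , sym c , sym d }
    ; trans = λ { (a , b , c , d) (a′ , b′ , c′ , d′) → trans a a′ , trans b b′ , trans c c′ , trans d d′ }
    }

  ≋-setoid : Setoid 0ℓ 0ℓ
  ≋-setoid = record { isEquivalence = ≋-isEquivalence }

  open Setoid ≋-setoid public using () renaming (refl to ≋-refl; sym to ≋-sym; trans to ≋-trans)
  open import Relation.Binary.Reasoning.Setoid ≋-setoid

  infixr 7 _⊙_

  _⊙_ : Mat → Mat → Mat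
  _⊙_ = _⊗_ A

  G : Carrier → Mat
  G = gen A

  I₂ : Mat
  I₂ = mat 1# 0# 0# 1#

  diag : Carrier → Carrier → Mat
  diag α β = mat α 0# 0# β

  ⊙-cong : ∀ {m m′ n n′} → m ≋ m′ → n ≋ n′ → m ⊙ n ≋ m′ ⊙ n′
  ⊙-cong (a , b , c , d) (e , f , g , h) =
    +-cong (*-cong a e) (*-cong b g) , +-cong (*-cong a f) (*-cong b h) ,
    +-cong (*-cong c e) (*-cong d g) , +-cong (*-cong c f) (*-cong d h)

  ⊙-assoc : ∀ m n o → (m ⊙ n) ⊙ o ≋ m ⊙ (n ⊙ o)
  ⊙-assoc (mat a b c d) (mat e f g h) (mat i j k l) =
    entry a b i k , entry a b j l , entry c d i k , entry c d j l
    where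
    entry : ∀ x y z w → (x * e + y * g) * z + (x * f + y * h) * w ≈ x * (e * z + f * w) + y * (g * z + h * w)
    entry = solve 8 (λ e f g h x y z w → (x :* e :+ y :* g) :* z :+ (x :* f :+ y :* h) :* w
                                       := x :* (e :* z :+ f :* w) :+ y :* (g :* z :+ h :* w)) refl e f g h

  gen-cong : ∀ {x y} → x ≈ y → G x ≋ G y
  gen-cong x≈y = x≈y , refl , refl , refl

  gen-⊙ : ∀ x a b c d → G x ⊙ mat a b c d ≋ mat (x * a - c) (x * b - d) a b
  gen-⊙ x a b c d = top a c , top b d , bottom a c , bottom b d
    where
    top : ∀ y z → x * y + - 1# * z ≈ x * y - z
    top = solve 3 (λ x y z → x :* y :+ :- :1# :* z := x :* y :- z) refl x
    bottom : ∀ y z → 1# * y + 0# * z ≈ y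
    bottom = solve 2 (λ y z → :1# :* y :+ :0# :* z := y) refl

  ⊙-diag : ∀ a b c d α β → mat a b c d ⊙ diag α β ≋ mat (a * α) (b * β) (c * α) (d * β)
  ⊙-diag a b c d α β = left a b , right a b , left c d , right c d
    where
    left : ∀ x y → x * α + y * 0# ≈ x * α
    left = solve 3 (λ α x y → x :* α :+ y :* :0# := x :* α) refl α
    right : ∀ x y → x * 0# + y * β ≈ y * β
    right = solve 3 (λ β x y → x :* :0# :+ y :* β := y :* β) refl β

  diag-⊙ : ∀ α β a b c d → diag α β ⊙ mat a b c d ≋ mat (α * a) (α * b) (β * c) (β * d)
  diag-⊙ α β a b c d = upper a c , upper b d , lower a c , lower b d
    where
    upper : ∀ x y → α * x + 0# * y ≈ α * x
    upper = solve 3 (λ α x y → α :* x :+ :0# :* y := α :* x) refl α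
    lower : ∀ x y → 0# * x + β * y ≈ β * y
    lower = solve 3 (λ β x y → :0# :* x :+ β :* y := β :* y) refl β

  ⊙-identityˡ : ∀ m → I₂ ⊙ m ≋ m
  ⊙-identityˡ (mat a b c d) = unit a c , unit b d , unit′ a c , unit′ b d
    where
    unit : ∀ x y → 1# * x + 0# * y ≈ x
    unit = solve 2 (λ x y → :1# :* x :+ :0# :* y := x) refl
    unit′ : ∀ x y → 0# * x + 1# * y ≈ y
    unit′ = solve 2 (λ x y → :0# :* x :+ :1# :* y := y) refl

  ⊙-identityʳ : ∀ m → m ⊙ I₂ ≋ m
  ⊙-identityʳ (mat a b c d) = unit a b , unit′ a b , unit c d , unit′ c d
    where
    unit : ∀ x y → x * 1# + y * 0# ≈ x
    unit = solve 2 (λ x y → x :* :1# :+ y :* :0# := x) refl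
    unit′ : ∀ x y → x * 0# + y * 1# ≈ y
    unit′ = solve 2 (λ x y → x :* :0# :+ y :* :1# := y) refl

  -- G (α a / β) = diag α β ⊙ G a ⊙ (diag β α)⁻¹, stated without inverses.
  gen-intertwines : ∀ {a a′ α β} → a′ * β ≈ α * a → G a′ ⊙ diag β α ≋ diag α β ⊙ G a
  gen-intertwines {a} {a′} {α} {β} a′β≈αa = ≋-trans (⊙-diag a′ (- 1#) 1# 0# β α)
    (≋-trans (a′β≈αa , *-comm (- 1#) α , *-comm 1# β , trans (zeroˡ α) (sym (zeroʳ β)))
             (≋-sym (diag-⊙ α β a (- 1#) 1# 0#)))

  Maux-cong : ∀ {n m m′} {v v′ : Vec Carrier n} → m ≋ m′ → Pointwise _≈_ v v′ →
    Maux A m (toList v) ≋ Maux A m′ (toList v′)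
  Maux-cong m≋m′ []               = m≋m′
  Maux-cong m≋m′ (x≈x′ ∷ v≈v′) = Maux-cong (⊙-cong (gen-cong x≈x′) m≋m′) v≈v′

  Maux-++ : ∀ m xs ys → Maux A m (xs ++ ys) ≡ Maux A (Maux A m xs) ys
  Maux-++ m []       ys = ≡.refl
  Maux-++ m (x ∷ xs) ys = Maux-++ (G x ⊙ m) xs ys

  M-++ : ∀ n {m} (v : Vec Carrier n) (w : Vec Carrier m) → M A (n ℕ.+ m) (v V.++ w) ≡ Maux A (M A n v) (toList w)
  M-++ n v w = ≡.trans (≡.cong (Maux A I₂) (toList-++ v w)) (Maux-++ I₂ (toList v) (toList w))

  M-cong : ∀ n {v v′ : Vec Carrier n} → Pointwise _≈_ v v′ → M A n v ≋ M A n v′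
  M-cong n = Maux-cong ≋-refl

  alternate : ∀ {n} → Carrier → Carrier → Vec Carrier n → Vec Carrier n
  alternate s t []      = []
  alternate s t (a ∷ v) = a * s ∷ alternate t s v

  diagAfter : ℕ → Carrier → Carrier → Mat
  diagAfter zero    α β = diag β α
  diagAfter (suc n) α β = diagAfter n β α

  Maux-alternate : ∀ {n} (v : Vec Carrier n) {s t α β D m m′} → s * β ≈ α → t * α ≈ β →
    m′ ⊙ D ≋ diag β α ⊙ m →
    Maux A m′ (toList (alternate s t v)) ⊙ D ≋ diagAfter n α β ⊙ Maux A m (toList v)
  Maux-alternate []      sβ≈α tα≈β inv = inv
  Maux-alternate (a ∷ v) {s} {t} {α} {β} {D} {m} {m′} sβ≈α tα≈β inv =
    Maux-alternate v tα≈β sβ≈α (begin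
      (G (a * s) ⊙ m′) ⊙ D   ≈⟨ ⊙-assoc _ _ _ ⟩
      G (a * s) ⊙ m′ ⊙ D     ≈⟨ ⊙-cong ≋-refl inv ⟩
      G (a * s) ⊙ diag β α ⊙ m ≈⟨ ⊙-assoc _ _ _ ⟨
      (G (a * s) ⊙ diag β α) ⊙ m ≈⟨ ⊙-cong (gen-intertwines asβ≈αa) ≋-refl ⟩
      (diag α β ⊙ G a) ⊙ m   ≈⟨ ⊙-assoc _ _ _ ⟩
      diag α β ⊙ G a ⊙ m     ∎)
    where
    asβ≈αa : a * s * β ≈ α * a
    asβ≈αa = trans (*-assoc a s β) (trans (*-congˡ sβ≈α) (*-comm a α))

  M-alternate : ∀ n (v : Vec Carrier n) {s t α β} → s * β ≈ α → t * α ≈ β →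
    M A n (alternate s t v) ⊙ diag β α ≋ diagAfter n α β ⊙ M A n v
  M-alternate n v sβ≈α tα≈β =
    Maux-alternate v sβ≈α tα≈β (≋-trans (⊙-identityˡ _) (≋-sym (⊙-identityʳ _)))

  diagAfter-+2 : ∀ n {α β} → diagAfter (n ℕ.+ 2) α β ≡ diagAfter n α β
  diagAfter-+2 zero    = ≡.refl
  diagAfter-+2 (suc n) = diagAfter-+2 n

  diagAfter-even : ∀ k {α β} → diagAfter (2 ℕ.* k) α β ≡ diag β α
  diagAfter-even zero    = ≡.refl
  diagAfter-even (suc k) {α} {β} =
    ≡.trans (≡.cong (λ j → diagAfter j α β) (ℕ.*-suc 2 k)) (diagAfter-even k)

  diagAfter-odd : ∀ n → (∃[ k ] n ≡ suc (2 ℕ.* k)) → ∀ {α β} → diagAfter n α β ≡ diag α β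
  diagAfter-odd .(suc (2 ℕ.* k)) (k , ≡.refl) = diagAfter-even k

module Continuants (A : FiniteCommRing) where
  open FiniteCommRing A hiding (zero)
  open CommutativeRingSolver cring
  open UnitsAndIdeals A
  open Matrices A
  open import Algebra.Properties.Ring ring using (x∙y⁻¹≈ε⇒x≈y; x≈y⇒x∙y⁻¹≈ε)
  open import Relation.Binary.Reasoning.Setoid setoid

  Kprev : Carrier → Carrier → List Carrier → Carrier
  Kprev p c []       = p
  Kprev p c (a ∷ as) = Kprev c (a * c - p) as

  -- K⁻ n (a₁ … aₙ) is K_{n-1}(a₁ … a_{n-1}), with K_{-1} = 0.
  K⁻ : (n : ℕ) → Vec Carrier n → Carrier
  K⁻ n v = Kprev 0# 1# (toList v)

  Kaux-∷ʳ : ∀ p c xs a → Kaux A p c (xs ++ a ∷ []) ≡ a * Kaux A p c xs - Kprev p c xs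
  Kaux-∷ʳ p c []       a = ≡.refl
  Kaux-∷ʳ p c (x ∷ xs) a = Kaux-∷ʳ c (x * c - p) xs a

  K-∷ʳ : ∀ n (v : Vec Carrier n) a → K A (suc n) (v ∷ʳ a) ≡ a * K A n v - K⁻ n v
  K-∷ʳ n v a = ≡.trans (≡.cong (Kaux A 0# 1#) (toList-∷ʳ a v)) (Kaux-∷ʳ 0# 1# (toList v) a)

  SL₂Column : Carrier → Carrier → Mat → Set
  SL₂Column c p m = ∃₂ λ q t → m ≋ mat c q p t × c * t - q * p ≈ 1#

  gen-SL₂Column : ∀ x {c p m} → SL₂Column c p m → SL₂Column (x * c - p) c (G x ⊙ m)
  gen-SL₂Column x {c} {p} (q , t , m≋ , det≈1) =
    x * q - t , q , ≋-trans (⊙-cong ≋-refl m≋) (gen-⊙ x c q p t) , (begin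
      (x * c - p) * q - (x * q - t) * c ≈⟨ solve 5 (λ x c p q t → (x :* c :- p) :* q :- (x :* q :- t) :* c
                                                              := c :* t :- q :* p) refl x c p q t ⟩
      c * t - q * p                     ≈⟨ det≈1 ⟩
      1#                                ∎)

  Maux-SL₂Column : ∀ xs {p c m} → SL₂Column c p m →
    SL₂Column (Kaux A p c xs) (Kprev p c xs) (Maux A m xs)
  Maux-SL₂Column []       col = col
  Maux-SL₂Column (x ∷ xs) col = Maux-SL₂Column xs (gen-SL₂Column x col)

  M-SL₂Column : ∀ n (v : Vec Carrier n) → SL₂Column (K A n v) (K⁻ n v) (M A n v)
  M-SL₂Column n v = Maux-SL₂Column (toList v)
    (0# , 1# , ≋-refl , solve 0 (:1# :* :1# :- :0# :* :0# := :1#) refl)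

  IsDiagSL₂ : Mat → Set
  IsDiagSL₂ (mat a b c d) = b ≈ 0# × c ≈ 0# × d * a ≈ 1#

  isDiagSL₂? : ∀ m → Dec (IsDiagSL₂ m)
  isDiagSL₂? (mat a b c d) = (b ≟ 0#) ×-dec ((c ≟ 0#) ×-dec ((d * a) ≟ 1#))

  IsDiagSL₂-resp : ∀ {m m′} → m ≋ m′ → IsDiagSL₂ m → IsDiagSL₂ m′
  IsDiagSL₂-resp (a≈ , b≈ , c≈ , d≈) (b≈0 , c≈0 , da≈1) =
    trans (sym b≈) b≈0 , trans (sym c≈) c≈0 , trans (*-cong (sym d≈) (sym a≈)) da≈1

  IsDiagU-resp : ∀ {z z′ m m′} → z ≈ z′ → m ≋ m′ → IsDiagU A z m → IsDiagU A z′ m′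
  IsDiagU-resp z≈z′ (a≈ , b≈ , c≈ , d≈) (a≈z , b≈0 , c≈0 , dz≈1) =
    trans (sym a≈) (trans a≈z z≈z′) , trans (sym b≈) b≈0 , trans (sym c≈) c≈0 ,
    trans (*-cong (sym d≈) (sym z≈z′)) dz≈1

  IsDiagU⇔ : ∀ {u} m → IsDiagU A u m ⇔ (Mat2.m11 m ≈ u × IsDiagSL₂ m)
  IsDiagU⇔ (mat a b c d) = mk⇔
    (λ { (a≈u , b≈0 , c≈0 , du≈1) → a≈u , b≈0 , c≈0 , trans (*-congˡ a≈u) du≈1 })
    (λ { (a≈u , b≈0 , c≈0 , da≈1) → a≈u , b≈0 , c≈0 , trans (*-congˡ (sym a≈u)) da≈1 })

  twoSteps-≋ : ∀ x y c q p t →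
    G y ⊙ G x ⊙ mat c q p t ≋ mat (y * (x * c - p) - c) (y * (x * q - t) - q) (x * c - p) (x * q - t)
  twoSteps-≋ x y c q p t =
    ≋-trans (⊙-cong ≋-refl (gen-⊙ x c q p t)) (gen-⊙ y (x * c - p) (x * q - t) c q)

  module _ {c q p t} (det≈1 : c * t - q * p ≈ 1#) where

    solvable⇒unit : ∀ {x} → x * c ≈ p → IsUnit A c
    solvable⇒unit {x} xc≈p = t - q * x , (begin
      c * (t - q * x)     ≈⟨ solve 4 (λ c t q x → c :* (t :- q :* x) := c :* t :- q :* (x :* c)) refl c t q x ⟩
      c * t - q * (x * c) ≈⟨ +-congˡ (-‿cong (*-congˡ xc≈p)) ⟩
      c * t - q * p       ≈⟨ det≈1 ⟩
      1#                  ∎)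

    c*[xq-t]≈-1 : ∀ {x} → x * c ≈ p → c * (x * q - t) ≈ - 1#
    c*[xq-t]≈-1 {x} xc≈p = begin
      c * (x * q - t)     ≈⟨ solve 4 (λ c x q t → c :* (x :* q :- t) := x :* c :* q :- c :* t) refl c x q t ⟩
      x * c * q - c * t   ≈⟨ +-congʳ (*-congʳ xc≈p) ⟩
      p * q - c * t       ≈⟨ solve 4 (λ p q c t → p :* q :- c :* t := :- (c :* t :- q :* p)) refl p q c t ⟩
      - (c * t - q * p)   ≈⟨ -‿cong det≈1 ⟩
      - 1#                ∎

    twoSteps-IsDiagSL₂ : ∀ x y → IsDiagSL₂ (G y ⊙ G x ⊙ mat c q p t) ⇔ (x * c ≈ p × y ≈ - (q * c))
    twoSteps-IsDiagSL₂ x y = mk⇔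
      (λ diag → let (b≈0 , c≈0 , _) = IsDiagSL₂-resp (twoSteps-≋ x y c q p t) diag
                    xc≈p = x∙y⁻¹≈ε⇒x≈y _ _ c≈0 in
                xc≈p , y-unique xc≈p (x∙y⁻¹≈ε⇒x≈y _ _ b≈0))
      (λ (xc≈p , y≈) → IsDiagSL₂-resp (≋-sym (twoSteps-≋ x y c q p t))
        (upper-right xc≈p y≈ , x≈y⇒x∙y⁻¹≈ε xc≈p , det′≈1 xc≈p))
      where
      y-unique : x * c ≈ p → y * (x * q - t) ≈ q → y ≈ - (q * c)
      y-unique xc≈p y[xq-t]≈q = begin
        y                           ≈⟨ solve 1 (λ y → y := :- (:- :1#) :* y) refl y ⟩
        - (- 1#) * y                ≈⟨ *-congʳ (-‿cong (sym (c*[xq-t]≈-1 xc≈p))) ⟩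
        - (c * (x * q - t)) * y     ≈⟨ solve 4 (λ c e y q → :- (c :* e) :* y := :- (c :* (y :* e))) refl c (x * q - t) y q ⟩
        - (c * (y * (x * q - t)))   ≈⟨ -‿cong (trans (*-congˡ y[xq-t]≈q) (*-comm c q)) ⟩
        - (q * c)                   ∎
      upper-right : x * c ≈ p → y ≈ - (q * c) → y * (x * q - t) - q ≈ 0#
      upper-right xc≈p y≈ = begin
        y * (x * q - t) - q            ≈⟨ +-congʳ (*-congʳ y≈) ⟩
        - (q * c) * (x * q - t) - q    ≈⟨ solve 3 (λ q c e → :- (q :* c) :* e :- q := :- (q :* (c :* e)) :- q)
                                                refl q c (x * q - t) ⟩
        - (q * (c * (x * q - t))) - q  ≈⟨ +-congʳ (-‿cong (*-congˡ (c*[xq-t]≈-1 xc≈p))) ⟩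
        - (q * - 1#) - q               ≈⟨ solve 1 (λ q → :- (q :* :- :1#) :- q := :0#) refl q ⟩
        0#                             ∎
      det′≈1 : x * c ≈ p → (x * q - t) * (y * (x * c - p) - c) ≈ 1#
      det′≈1 xc≈p = begin
        (x * q - t) * (y * (x * c - p) - c)  ≈⟨ *-congˡ (+-congʳ (*-congˡ (x≈y⇒x∙y⁻¹≈ε xc≈p))) ⟩
        (x * q - t) * (y * 0# - c)           ≈⟨ solve 3 (λ e y c → e :* (y :* :0# :- c) := :- (c :* e)) refl (x * q - t) y c ⟩
        - (c * (x * q - t))                  ≈⟨ -‿cong (c*[xq-t]≈-1 xc≈p) ⟩
        - (- 1#)                             ≈⟨ solve 0 (:- (:- :1#) := :1#) refl ⟩
        1#                                   ∎

  IsDiagU-scale : ∀ {u u⁻¹ z} m m′ → u * u⁻¹ ≈ 1# → m′ ⊙ diag 1# u ≋ diag u 1# ⊙ m →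
    IsDiagU A z m ⇔ IsDiagU A (u * z) m′
  IsDiagU-scale {u} {u⁻¹} {z} (mat a b c d) (mat a′ b′ c′ d′) uu⁻¹≈1 intertwined = mk⇔
    (λ (a≈z , b≈0 , c≈0 , dz≈1) →
      trans a′≈ua (*-congˡ a≈z) ,
      cancel (trans b′u≈ub (trans (*-congˡ b≈0) (trans (zeroʳ u) (sym (zeroˡ u))))) ,
      trans c′≈c c≈0 ,
      trans (solve 3 (λ d u z → d :* (u :* z) := d :* u :* z) refl d′ u z) (trans (*-congʳ d′u≈d) dz≈1))
    (λ (a′≈uz , b′≈0 , c′≈0 , d′uz≈1) →
      cancel (trans (*-comm a u) (trans (sym a′≈ua) (trans a′≈uz (*-comm u z)))) ,
      cancel (trans (*-comm b u) (trans (sym b′u≈ub) (trans (*-congʳ b′≈0) (trans (zeroˡ u) (sym (zeroˡ u)))))) ,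
      trans (sym c′≈c) c′≈0 ,
      trans (*-congʳ (sym d′u≈d)) (trans (solve 3 (λ d u z → d :* u :* z := d :* (u :* z)) refl d′ u z) d′uz≈1))
    where
    cancel : ∀ {x y} → x * u ≈ y * u → x ≈ y
    cancel = *-cancelʳ-unit uu⁻¹≈1
    entries : mat (a′ * 1#) (b′ * u) (c′ * 1#) (d′ * u) ≋ mat (u * a) (u * b) (1# * c) (1# * d)
    entries = ≋-trans (≋-sym (⊙-diag a′ b′ c′ d′ 1# u)) (≋-trans intertwined (diag-⊙ u 1# a b c d))
    a′≈ua : a′ ≈ u * a
    a′≈ua = trans (sym (*-identityʳ a′)) (proj₁ entries)
    b′u≈ub : b′ * u ≈ u * b
    b′u≈ub = proj₁ (proj₂ entries)
    c′≈c : c′ ≈ c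
    c′≈c = trans (sym (*-identityʳ c′)) (trans (proj₁ (proj₂ (proj₂ entries))) (*-identityˡ c))
    d′u≈d : d′ * u ≈ d
    d′u≈d = trans (proj₂ (proj₂ (proj₂ entries))) (*-identityˡ d)

  module _ (local : IsLocal A) where

    -- a c = z + p would make p, and hence c t - q p = 1, a combination of nonunits.
    unimodular-shift-nonunit : ∀ {c q p t} → c * t - q * p ≈ 1# → ¬ IsUnit A c →
      ∀ {z} → ¬ IsUnit A z → ∀ a → ¬ a * c ≈ z + p
    unimodular-shift-nonunit {c} {q} {p} {t} det≈1 c-nonunit {z} z-nonunit a ac≈z+p =
      nonunit-resp 1≈ (nonunit-combination local t (- q) c-nonunit p-nonunit) (1# , *-identityˡ 1#)
      where
      p-nonunit : ¬ IsUnit A p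
      p-nonunit = nonunit-resp
        (trans (+-congʳ ac≈z+p) (solve 2 (λ z p → z :+ p :+ :- :1# :* z := p) refl z p))
        (nonunit-combination local a (- 1#) c-nonunit z-nonunit)
      1≈ : t * c + - q * p ≈ 1#
      1≈ = trans (solve 4 (λ t c q p → t :* c :+ :- q :* p := c :* t :- q :* p) refl t c q p) det≈1

module Counting (A : FiniteCommRing) where
  open FiniteCommRing A hiding (zero)
  open UnitsAndIdeals A
  open Matrices A
  open Continuants A
  open ≡.≡-Reasoning

  Distinct : List Carrier → Set
  Distinct = AllPairs (λ x y → ¬ x ≈ y)

  module _ {Q : Pred Carrier 0ℓ} (Q? : ∀ x → Dec (Q x)) where
    ∑𝟙≡0 : ∀ {xs} → All (¬_ ∘ Q) xs → ∑[ x ∈ xs ] 𝟙 (Q? x) ≡ 0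
    ∑𝟙≡0 []            = ≡.refl
    ∑𝟙≡0 (¬qx ∷ ¬qxs) = ≡.cong₂ ℕ._+_ (𝟙-no (Q? _) ¬qx) (∑𝟙≡0 ¬qxs)

    private
      only-once : (∀ {a b} → Q a → Q b → a ≈ b) → ∀ {x ys} → Q x → All (λ y → ¬ x ≈ y) ys → All (¬_ ∘ Q) ys
      only-once unique qx = All.map (λ x≉y qy → x≉y (unique qx qy))

    ∑𝟙≡1 : ∀ {xs} → Distinct xs → (∀ {a b} → Q a → Q b → a ≈ b) → Any Q xs → ∑[ x ∈ xs ] 𝟙 (Q? x) ≡ 1
    ∑𝟙≡1 (x≉xs ∷ _) unique (here qx) =
      ≡.cong₂ ℕ._+_ (𝟙-yes (Q? _) qx) (∑𝟙≡0 (only-once unique qx x≉xs))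
    ∑𝟙≡1 {x ∷ _} (x≉xs ∷ xs-distinct) unique (there qxs) with Q? x
    ... | yes qx = contradiction qxs (All¬⇒¬Any (only-once unique qx x≉xs))
    ... | no _   = ∑𝟙≡1 xs-distinct unique qxs

    ∑𝟙-elems≡1 : Q Respects _≈_ → (∀ {a b} → Q a → Q b → a ≈ b) → ∀ {x} → Q x →
      ∑[ x ∈ elems ] 𝟙 (Q? x) ≡ 1
    ∑𝟙-elems≡1 resp unique {x} qx = ∑𝟙≡1 distinct unique (Any.map (λ x≈y → resp x≈y qx) (complete x))

  ∈-filter : ∀ {P : Pred Carrier 0ℓ} (P? : ∀ x → Dec (P x)) → P Respects _≈_ →
    ∀ {y} → P y → Any (y ≈_) (filter P? elems)
  ∈-filter P? resp {y} py with AnyP.filter⁺ P? (complete y)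
  ... | inj₁ y∈ = y∈
  ... | inj₂ ¬p = contradiction (resp (AnyP.lookup-result (complete y)) py) ¬p

  ∑-nonunits-𝟙≈ : ∀ y → ∑[ c ∈ nonunits A ] 𝟙 (y ≟ c) ≡ 𝟙 (¬? (isUnit? A y))
  ∑-nonunits-𝟙≈ y with isUnit? A y
  ... | yes y-unit = ∑𝟙≡0 (y ≟_)
          (All.map (λ c-nonunit y≈c → c-nonunit (IsUnit-resp y≈c y-unit)) (all-filter (¬? ∘ isUnit? A) elems))
  ... | no y-nonunit = ∑𝟙≡1 (y ≟_) (AllPairs.filter⁺ (¬? ∘ isUnit? A) distinct) (λ y≈a y≈b → trans (sym y≈a) y≈b)
          (∈-filter (¬? ∘ isUnit? A) nonunit-resp y-nonunit)

  ∑-units-IsDiagU : ∀ m → ∑[ u ∈ units A ] 𝟙 (isDiagU? A u m) ≡ 𝟙 (isDiagSL₂? m)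
  ∑-units-IsDiagU m@(mat a b c d) with isDiagSL₂? m
  ... | yes m-diag = ∑𝟙≡1 (λ u → isDiagU? A u m) (AllPairs.filter⁺ (isUnit? A) distinct)
          (λ m-diag-u m-diag-v → trans (sym (proj₁ m-diag-u)) (proj₁ m-diag-v))
          (Any.map (λ a≈u → Equivalence.from (IsDiagU⇔ m) (a≈u , m-diag))
            (∈-filter (isUnit? A) IsUnit-resp (d , trans (*-comm a d) (proj₂ (proj₂ m-diag)))))
  ... | no ¬m-diag = ∑𝟙≡0 (λ u → isDiagU? A u m) {units A}
          (All.tabulate (λ _ m-diag-u → ¬m-diag (proj₂ (Equivalence.to (IsDiagU⇔ m) m-diag-u))))

  ∑-𝟙≈ : ∀ z → ∑[ y ∈ elems ] 𝟙 (y ≟ z) ≡ 1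
  ∑-𝟙≈ z = ∑𝟙-elems≡1 (_≟ z) (λ a≈b a≈z → trans (sym a≈b) a≈z) (λ a≈z b≈z → trans a≈z (sym b≈z)) refl

  ∑-solutions-unit : ∀ {c} → IsUnit A c → ∀ b → ∑[ a ∈ elems ] 𝟙 ((a * c) ≟ b) ≡ 1
  ∑-solutions-unit {c} (c⁻¹ , cc⁻¹≈1) b = ∑𝟙-elems≡1 (λ a → (a * c) ≟ b)
    (λ a≈a′ ac≈b → trans (*-congʳ (sym a≈a′)) ac≈b)
    (λ ac≈b a′c≈b → *-cancelʳ-unit cc⁻¹≈1 (trans ac≈b (sym a′c≈b)))
    (*-unit-solution b cc⁻¹≈1)

  ∑-solutions : ∀ {c b} → (¬ IsUnit A c → ∀ a → ¬ a * c ≈ b) →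
    ∑[ a ∈ elems ] 𝟙 ((a * c) ≟ b) ≡ 𝟙 (isUnit? A c)
  ∑-solutions {c} {b} no-solution with isUnit? A c
  ... | yes c-unit    = ∑-solutions-unit c-unit b
  ... | no c-nonunit  = ∑𝟙≡0 (λ a → (a * c) ≟ b) {elems} (All.tabulate (λ {a} _ → no-solution c-nonunit a))

  ∑-pick : ∀ g → g Preserves _≈_ ⟶ _≡_ → ∀ z → ∑[ b ∈ elems ] (𝟙 (z ≟ b) ℕ.* g b) ≡ g z
  ∑-pick g g-resp z = begin
    ∑[ b ∈ elems ] (𝟙 (z ≟ b) ℕ.* g b) ≡⟨ ∑-cong elems picked ⟩
    ∑[ b ∈ elems ] (𝟙 (b ≟ z) ℕ.* g z) ≡⟨ ∑-*ʳ elems (λ b → 𝟙 (b ≟ z)) (g z) ⟩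
    ∑[ b ∈ elems ] 𝟙 (b ≟ z) ℕ.* g z   ≡⟨ ≡.cong (ℕ._* g z) (∑-𝟙≈ z) ⟩
    1 ℕ.* g z                          ≡⟨ ℕ.*-identityˡ (g z) ⟩
    g z                                ∎
    where
    picked : ∀ b → 𝟙 (z ≟ b) ℕ.* g b ≡ 𝟙 (b ≟ z) ℕ.* g z
    picked b with z ≟ b | b ≟ z
    ... | yes z≈b | yes _   = ≡.cong (ℕ._+ 0) (g-resp (sym z≈b))
    ... | yes z≈b | no b≉z  = contradiction (sym z≈b) b≉z
    ... | no z≉b  | yes b≈z = contradiction (sym b≈z) z≉b
    ... | no _    | no _    = ≡.refl

  ∑-reindex-*unit : ∀ {s} → IsUnit A s → ∀ g → g Preserves _≈_ ⟶ _≡_ →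
    ∑[ a ∈ elems ] g (a * s) ≡ ∑ elems g
  ∑-reindex-*unit {s} s-unit g g-resp = begin
    ∑[ a ∈ elems ] g (a * s)
      ≡⟨ ∑-cong elems (λ a → ∑-pick g g-resp (a * s)) ⟨
    ∑[ a ∈ elems ] ∑[ b ∈ elems ] (𝟙 ((a * s) ≟ b) ℕ.* g b)
      ≡⟨ ∑-comm elems elems _ ⟩
    ∑[ b ∈ elems ] ∑[ a ∈ elems ] (𝟙 ((a * s) ≟ b) ℕ.* g b)
      ≡⟨ ∑-cong elems (λ b → ∑-*ʳ elems _ (g b)) ⟩
    ∑[ b ∈ elems ] (∑[ a ∈ elems ] 𝟙 ((a * s) ≟ b) ℕ.* g b)
      ≡⟨ ∑-cong elems (λ b → ≡.cong (ℕ._* g b) (∑-solutions-unit s-unit b)) ⟩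
    ∑[ b ∈ elems ] (1 ℕ.* g b)
      ≡⟨ ∑-cong elems (λ b → ℕ.*-identityˡ (g b)) ⟩
    ∑ elems g ∎

  ∑-tuples-suc : ∀ n f → ∑ (tuples A (suc n)) f ≡ ∑[ a ∈ elems ] ∑[ v ∈ tuples A n ] f (a ∷ v)
  ∑-tuples-suc n f = ≡.trans (∑-concatMap elems _ f) (∑-cong elems (λ a → ∑-map (tuples A n) (a ∷_) f))

  ∑-tuples-2 : ∀ f → ∑ (tuples A 2) f ≡ ∑[ x ∈ elems ] ∑[ y ∈ elems ] f (x ∷ y ∷ [])
  ∑-tuples-2 f = ≡.trans (∑-tuples-suc 1 f) (∑-cong elems (λ x →
    ≡.trans (∑-tuples-suc 0 _) (∑-cong elems (λ y → ℕ.+-identityʳ _))))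

  ∑-tuples-++ : ∀ n m f → ∑ (tuples A (n ℕ.+ m)) f ≡ ∑[ v ∈ tuples A n ] ∑[ w ∈ tuples A m ] f (v V.++ w)
  ∑-tuples-++ zero    m f = ≡.sym (ℕ.+-identityʳ _)
  ∑-tuples-++ (suc n) m f = begin
    ∑ (tuples A (suc n ℕ.+ m)) f
      ≡⟨ ∑-tuples-suc (n ℕ.+ m) f ⟩
    ∑[ a ∈ elems ] ∑[ v ∈ tuples A (n ℕ.+ m) ] f (a ∷ v)
      ≡⟨ ∑-cong elems (λ a → ∑-tuples-++ n m (f ∘ (a ∷_))) ⟩
    ∑[ a ∈ elems ] ∑[ v ∈ tuples A n ] ∑[ w ∈ tuples A m ] f (a ∷ (v V.++ w))
      ≡⟨ ∑-tuples-suc n _ ⟨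
    ∑[ v ∈ tuples A (suc n) ] ∑[ w ∈ tuples A m ] f (v V.++ w) ∎

  ∑-tuples-∷ʳ : ∀ n f → ∑ (tuples A (suc n)) f ≡ ∑[ v ∈ tuples A n ] ∑[ a ∈ elems ] f (v ∷ʳ a)
  ∑-tuples-∷ʳ zero    f =
    ≡.trans (∑-tuples-suc zero f) (≡.trans (∑-cong elems (λ _ → ℕ.+-identityʳ _)) (≡.sym (ℕ.+-identityʳ _)))
  ∑-tuples-∷ʳ (suc n) f = begin
    ∑ (tuples A (suc (suc n))) f
      ≡⟨ ∑-tuples-suc (suc n) f ⟩
    ∑[ b ∈ elems ] ∑[ v ∈ tuples A (suc n) ] f (b ∷ v)
      ≡⟨ ∑-cong elems (λ b → ∑-tuples-∷ʳ n (f ∘ (b ∷_))) ⟩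
    ∑[ b ∈ elems ] ∑[ v ∈ tuples A n ] ∑[ a ∈ elems ] f (b ∷ (v ∷ʳ a))
      ≡⟨ ∑-tuples-suc n _ ⟨
    ∑[ v ∈ tuples A (suc n) ] ∑[ a ∈ elems ] f (v ∷ʳ a) ∎

  ∑-tuples-1 : ∀ n → ∑[ v ∈ tuples A n ] 1 ≡ card A ℕ.^ n
  ∑-tuples-1 zero    = ≡.refl
  ∑-tuples-1 (suc n) = ≡.trans (∑-tuples-suc n _) (≡.trans (∑-const elems _) (≡.cong (card A ℕ.*_) (∑-tuples-1 n)))

  ∑-tuples-alternate : ∀ n {s t} → IsUnit A s → IsUnit A t → ∀ f → f Preserves Pointwise _≈_ ⟶ _≡_ →
    ∑[ v ∈ tuples A n ] f (alternate s t v) ≡ ∑ (tuples A n) f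
  ∑-tuples-alternate zero    s-unit t-unit f f-resp = ≡.refl
  ∑-tuples-alternate (suc n) {s} {t} s-unit t-unit f f-resp = begin
    ∑[ v ∈ tuples A (suc n) ] f (alternate s t v)
      ≡⟨ ∑-tuples-suc n _ ⟩
    ∑[ a ∈ elems ] ∑[ v ∈ tuples A n ] f (a * s ∷ alternate t s v)
      ≡⟨ ∑-cong elems (λ a → ∑-tuples-alternate n t-unit s-unit _ (f-resp ∘ (refl ∷_))) ⟩
    ∑[ a ∈ elems ] ∑[ v ∈ tuples A n ] f (a * s ∷ v)
      ≡⟨ ∑-reindex-*unit s-unit _ (λ a≈b → ∑-cong (tuples A n) (λ v → f-resp (a≈b ∷ PW.refl refl))) ⟩
    ∑[ a ∈ elems ] ∑[ v ∈ tuples A n ] f (a ∷ v)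
      ≡⟨ ∑-tuples-suc n f ⟨
    ∑ (tuples A (suc n)) f ∎

  w≡∑ : ∀ N z → w A N z ≡ ∑[ t ∈ tuples A N ] 𝟙 (isDiagU? A z (M A N t))
  w≡∑ N z = length-filter≡∑𝟙 (λ t → isDiagU? A z (M A N t)) (tuples A N)

  ∑-twoSteps : ∀ {c p m} → SL₂Column c p m →
    ∑[ x ∈ elems ] ∑[ y ∈ elems ] 𝟙 (isDiagSL₂? (G y ⊙ G x ⊙ m)) ≡ 𝟙 (isUnit? A c)
  ∑-twoSteps {c} {p} {m} (q , t , m≋ , det≈1) = begin
    ∑[ x ∈ elems ] ∑[ y ∈ elems ] 𝟙 (isDiagSL₂? (G y ⊙ G x ⊙ m))
      ≡⟨ ∑-cong elems (λ x → ∑-cong elems (λ y → ≡.trans (𝟙-⇔ _ (solution? x y) (to x y) (from x y))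
                                                          (𝟙-× ((x * c) ≟ p) (y ≟ (- (q * c))) (solution? x y)))) ⟩
    ∑[ x ∈ elems ] ∑[ y ∈ elems ] (𝟙 ((x * c) ≟ p) ℕ.* 𝟙 (y ≟ (- (q * c))))
      ≡⟨ ∑-cong elems (λ x → ∑-*ˡ elems (𝟙 ((x * c) ≟ p)) _) ⟩
    ∑[ x ∈ elems ] (𝟙 ((x * c) ≟ p) ℕ.* ∑[ y ∈ elems ] 𝟙 (y ≟ (- (q * c))))
      ≡⟨ ∑-cong elems (λ x → ≡.trans (≡.cong (𝟙 ((x * c) ≟ p) ℕ.*_) (∑-𝟙≈ _)) (ℕ.*-identityʳ _)) ⟩
    ∑[ x ∈ elems ] 𝟙 ((x * c) ≟ p)
      ≡⟨ ∑-solutions (λ c-nonunit x xc≈p → c-nonunit (solvable⇒unit det≈1 xc≈p)) ⟩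
    𝟙 (isUnit? A c) ∎
    where
    solution? : ∀ x y → Dec (x * c ≈ p × y ≈ - (q * c))
    solution? x y = ((x * c) ≟ p) ×-dec (y ≟ (- (q * c)))
    twoSteps≋ : ∀ x y → G y ⊙ G x ⊙ m ≋ G y ⊙ G x ⊙ mat c q p t
    twoSteps≋ x y = ⊙-cong ≋-refl (⊙-cong ≋-refl m≋)
    to : ∀ x y → IsDiagSL₂ (G y ⊙ G x ⊙ m) → x * c ≈ p × y ≈ - (q * c)
    to x y = Equivalence.to (twoSteps-IsDiagSL₂ det≈1 x y) ∘ IsDiagSL₂-resp (twoSteps≋ x y)
    from : ∀ x y → x * c ≈ p × y ≈ - (q * c) → IsDiagSL₂ (G y ⊙ G x ⊙ m)
    from x y = IsDiagSL₂-resp (≋-sym (twoSteps≋ x y)) ∘ Equivalence.from (twoSteps-IsDiagSL₂ det≈1 x y)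

  sumW≡∑𝟙unit : ∀ n → sumW A (n ℕ.+ 2) ≡ ∑[ v ∈ tuples A n ] 𝟙 (isUnit? A (K A n v))
  sumW≡∑𝟙unit n = begin
    sumW A (n ℕ.+ 2)
      ≡⟨ ∑-cong (units A) (w≡∑ (n ℕ.+ 2)) ⟩
    ∑[ u ∈ units A ] ∑[ t ∈ tuples A (n ℕ.+ 2) ] 𝟙 (isDiagU? A u (M A (n ℕ.+ 2) t))
      ≡⟨ ∑-comm (units A) (tuples A (n ℕ.+ 2)) _ ⟩
    ∑[ t ∈ tuples A (n ℕ.+ 2) ] ∑[ u ∈ units A ] 𝟙 (isDiagU? A u (M A (n ℕ.+ 2) t))
      ≡⟨ ∑-cong (tuples A (n ℕ.+ 2)) (∑-units-IsDiagU ∘ M A (n ℕ.+ 2)) ⟩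
    ∑[ t ∈ tuples A (n ℕ.+ 2) ] 𝟙 (isDiagSL₂? (M A (n ℕ.+ 2) t))
      ≡⟨ ∑-tuples-++ n 2 _ ⟩
    ∑[ v ∈ tuples A n ] ∑[ xy ∈ tuples A 2 ] 𝟙 (isDiagSL₂? (M A (n ℕ.+ 2) (v V.++ xy)))
      ≡⟨ ∑-cong (tuples A n) (λ v → ≡.trans (∑-tuples-2 _) (∑-cong elems (λ x → ∑-cong elems (λ y →
           ≡.cong (𝟙 ∘ isDiagSL₂?) (M-++ n v (x ∷ y ∷ [])))))) ⟩
    ∑[ v ∈ tuples A n ] ∑[ x ∈ elems ] ∑[ y ∈ elems ] 𝟙 (isDiagSL₂? (G y ⊙ G x ⊙ M A n v))
      ≡⟨ ∑-cong (tuples A n) (λ v → ∑-twoSteps (M-SL₂Column n v)) ⟩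
    ∑[ v ∈ tuples A n ] 𝟙 (isUnit? A (K A n v)) ∎

  module _ (local : IsLocal A) where

    ∑-K≈nonunit : ∀ m {z} → ¬ IsUnit A z →
      ∑[ v ∈ tuples A (suc m) ] 𝟙 (K A (suc m) v ≟ z) ≡ ∑[ v ∈ tuples A m ] 𝟙 (isUnit? A (K A m v))
    ∑-K≈nonunit m {z} z-nonunit = begin
      ∑[ v ∈ tuples A (suc m) ] 𝟙 (K A (suc m) v ≟ z)
        ≡⟨ ∑-tuples-∷ʳ m _ ⟩
      ∑[ v ∈ tuples A m ] ∑[ a ∈ elems ] 𝟙 (K A (suc m) (v ∷ʳ a) ≟ z)
        ≡⟨ ∑-cong (tuples A m) (λ v → ∑-cong elems (λ a → 𝟙-⇔ _ _ (to v a) (from v a))) ⟩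
      ∑[ v ∈ tuples A m ] ∑[ a ∈ elems ] 𝟙 ((a * K A m v) ≟ (z + K⁻ m v))
        ≡⟨ ∑-cong (tuples A m) (λ v → ∑-solutions (no-solution v)) ⟩
      ∑[ v ∈ tuples A m ] 𝟙 (isUnit? A (K A m v)) ∎
      where
      to : ∀ v a → K A (suc m) (v ∷ʳ a) ≈ z → a * K A m v ≈ z + K⁻ m v
      to v a = Equivalence.to x-y≈z⇔x≈z+y ∘ ≡.subst (_≈ z) (K-∷ʳ m v a)
      from : ∀ v a → a * K A m v ≈ z + K⁻ m v → K A (suc m) (v ∷ʳ a) ≈ z
      from v a = ≡.subst (_≈ z) (≡.sym (K-∷ʳ m v a)) ∘ Equivalence.from x-y≈z⇔x≈z+y
      no-solution : ∀ v → ¬ IsUnit A (K A m v) → ∀ a → ¬ a * K A m v ≈ z + K⁻ m v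
      no-solution v K-nonunit with M-SL₂Column m v
      ... | _ , _ , _ , det≈1 = unimodular-shift-nonunit local det≈1 K-nonunit z-nonunit

    r*nonunits≡∑𝟙nonunit : ∀ m →
      r A (suc m) ℕ.* length (nonunits A) ≡ ∑[ v ∈ tuples A (suc m) ] 𝟙 (¬? (isUnit? A (K A (suc m) v)))
    r*nonunits≡∑𝟙nonunit m = begin
      r A (suc m) ℕ.* length (nonunits A)
        ≡⟨ ℕ.*-comm (r A (suc m)) _ ⟩
      length (nonunits A) ℕ.* r A (suc m)
        ≡⟨ ∑-const (nonunits A) _ ⟨
      ∑[ z ∈ nonunits A ] r A (suc m)
        ≡⟨ ∑-cong-All (all-filter (¬? ∘ isUnit? A) elems)
             (λ z-nonunit → ≡.trans r≡ (≡.sym (∑-K≈nonunit m z-nonunit))) ⟩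
      ∑[ z ∈ nonunits A ] ∑[ v ∈ tuples A (suc m) ] 𝟙 (K A (suc m) v ≟ z)
        ≡⟨ ∑-comm (nonunits A) (tuples A (suc m)) _ ⟩
      ∑[ v ∈ tuples A (suc m) ] ∑[ z ∈ nonunits A ] 𝟙 (K A (suc m) v ≟ z)
        ≡⟨ ∑-cong (tuples A (suc m)) (∑-nonunits-𝟙≈ ∘ K A (suc m)) ⟩
      ∑[ v ∈ tuples A (suc m) ] 𝟙 (¬? (isUnit? A (K A (suc m) v))) ∎
      where
      r≡ : r A (suc m) ≡ ∑[ v ∈ tuples A m ] 𝟙 (isUnit? A (K A m v))
      r≡ = ≡.trans (length-filter≡∑𝟙 _ (tuples A (suc m))) (∑-K≈nonunit m (0-nonunit local))

    r*nonunits+sumW≡card^ : ∀ m →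
      r A (suc m) ℕ.* length (nonunits A) ℕ.+ sumW A (suc m ℕ.+ 2) ≡ card A ℕ.^ suc m
    r*nonunits+sumW≡card^ m = begin
      r A n ℕ.* length (nonunits A) ℕ.+ sumW A (n ℕ.+ 2)
        ≡⟨ ≡.cong₂ ℕ._+_ (r*nonunits≡∑𝟙nonunit m) (sumW≡∑𝟙unit n) ⟩
      ∑[ v ∈ tuples A n ] 𝟙 (¬? (unit? v)) ℕ.+ ∑[ v ∈ tuples A n ] 𝟙 (unit? v)
        ≡⟨ ∑-+ (tuples A n) _ _ ⟨
      ∑[ v ∈ tuples A n ] (𝟙 (¬? (unit? v)) ℕ.+ 𝟙 (unit? v))
        ≡⟨ ∑-cong (tuples A n) (𝟙-¬?+𝟙 ∘ unit?) ⟩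
      ∑[ v ∈ tuples A n ] 1
        ≡⟨ ∑-tuples-1 n ⟩
      card A ℕ.^ n ∎
      where
      n = suc m
      unit? : ∀ v → Dec (IsUnit A (K A n v))
      unit? v = isUnit? A (K A n v)

  w-scale : ∀ n → (∃[ k ] n ≡ suc (2 ℕ.* k)) → ∀ {u z z′} → IsUnit A u → z′ ≈ u * z →
    w A (n ℕ.+ 2) z′ ≡ w A (n ℕ.+ 2) z
  w-scale n n-odd {u} {z} {z′} (u⁻¹ , uu⁻¹≈1) z′≈uz = begin
    w A N z′
      ≡⟨ w≡∑ N z′ ⟩
    ∑[ t ∈ tuples A N ] f t
      ≡⟨ ∑-tuples-alternate N (u⁻¹ , uu⁻¹≈1) (u , u⁻¹u≈1) f f-resp ⟨
    ∑[ t ∈ tuples A N ] f (alternate u u⁻¹ t)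
      ≡⟨ ∑-cong (tuples A N) (λ t → 𝟙-⇔ _ _ (to t) (from t)) ⟩
    ∑[ t ∈ tuples A N ] 𝟙 (isDiagU? A z (M A N t))
      ≡⟨ w≡∑ N z ⟨
    w A N z ∎
    where
    N = n ℕ.+ 2
    u⁻¹u≈1 : u⁻¹ * u ≈ 1#
    u⁻¹u≈1 = trans (*-comm u⁻¹ u) uu⁻¹≈1
    f : Vec Carrier N → ℕ
    f t = 𝟙 (isDiagU? A z′ (M A N t))
    f-resp : f Preserves Pointwise _≈_ ⟶ _≡_
    f-resp t≈t′ = 𝟙-⇔ _ _ (IsDiagU-resp refl (M-cong N t≈t′)) (IsDiagU-resp refl (M-cong N (PW.sym sym t≈t′)))
    scaled : ∀ t → IsDiagU A z (M A N t) ⇔ IsDiagU A (u * z) (M A N (alternate u u⁻¹ t))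
    scaled t = IsDiagU-scale (M A N t) _ uu⁻¹≈1
      (≡.subst (λ D → M A N (alternate u u⁻¹ t) ⊙ diag 1# u ≋ D ⊙ M A N t)
        (≡.trans (diagAfter-+2 n) (diagAfter-odd n n-odd))
        (M-alternate N t (*-identityʳ u) u⁻¹u≈1))
    to : ∀ t → IsDiagU A z′ (M A N (alternate u u⁻¹ t)) → IsDiagU A z (M A N t)
    to t = Equivalence.from (scaled t) ∘ IsDiagU-resp z′≈uz ≋-refl
    from : ∀ t → IsDiagU A z (M A N t) → IsDiagU A z′ (M A N (alternate u u⁻¹ t))
    from t = IsDiagU-resp (sym z′≈uz) ≋-refl ∘ Equivalence.to (scaled t)

  sumW-odd : ∀ n → (∃[ k ] n ≡ suc (2 ℕ.* k)) → sumW A (n ℕ.+ 2) ≡ length (units A) ℕ.* w A (n ℕ.+ 2) 1#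
  sumW-odd n n-odd = ≡.trans
    (∑-cong-All (all-filter (isUnit? A) elems) (λ {u} u-unit → w-scale n n-odd u-unit (sym (*-identityʳ u))))
    (∑-const (units A) _)

open import Data.Nat using (_+_; _*_; _^_; _≤_; s≤s; z≤n)
open Counting

theorem1p2 : (A : FiniteCommRing) → IsLocal A → (n : ℕ) → 1 ≤ n →
    (r A n * length (nonunits A) + sumW A (n + 2) ≡ card A ^ n)
    × ((∃[ k ] n ≡ suc (2 * k)) →
       r A n * length (nonunits A) + length (units A) * w A (n + 2) (FiniteCommRing.1# A) ≡ card A ^ n)
theorem1p2 A local (suc m) (s≤s z≤n) = count , count-odd
  where
  count : r A (suc m) * length (nonunits A) + sumW A (suc m + 2) ≡ card A ^ suc m
  count = r*nonunits+sumW≡card^ A local m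
  count-odd : (∃[ k ] suc m ≡ suc (2 * k)) →
    r A (suc m) * length (nonunits A) + length (units A) * w A (suc m + 2) (FiniteCommRing.1# A) ≡ card A ^ suc m
  count-odd n-odd = ≡.subst (λ s → r A (suc m) * length (nonunits A) + s ≡ card A ^ suc m) (sumW-odd A (suc m) n-odd) count
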